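{- Let $G=(V,E)$ be a graph with $n=|V|$ vertices, let $\alpha(G)$ be the cardinality of a maximum stable set of $G$, and let $X=\{X_1,\dots,X_{|X|}\}$ be a valid coloring of $G$ with $|X|$ colors, with $\Sigma(X)=\sum_{i=1}^{|X|} i\,|X_i|$. For each integer $k$ with $|X|<k\le n$, let $\lambda_k=\min(\alpha(G),\,n-k+1)$ and define the sequence $M_k=(M_k[1],\dots,M_k[k])$ of length $k$ as follows: if $\lambda_k=1$, then $M_k[x]=1$ for all $x$; if $\lambda_k\ge 2$, let $\beta_k=\left\lfloor \frac{n-k}{\lambda_k-1}\right\rfloor$ and put $M_k[x]=\lambda_k$ for $1\le x\le \min(\beta_k,k)$, $M_k[\beta_k+1]=n-\beta_k\lambda_k-(k-\beta_k-1)$ if $\beta_k+1\le k$, and $M_k[x]=1$ for $\beta_k+1<x\le k$. Let $\Sigma(M_k)=\sum_{x=1}^k x\,M_k[x]$. Suppose there exists an integer $k$ with $|X|<k\le n$ and $\Sigma(M_k)>\Sigma(X)$, and let $k^*$ be the least such $k$. Then $s(G)\le k^*-1$.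
   Context: A stable set of $G$ is a set of pairwise non-adjacent vertices. A coloring of $G$ with $k$ colors is a map $c:V\to\{1,\dots,k\}$; it is valid if $c(u)\ne c(v)$ for every edge $(u,v)\in E$. Color $i$ has weight $i$, and the sum of a coloring $X=\{X_1,\dots,X_k\}$ (with $X_i=c^{ -1}(i)$) is $\Sigma(X)=\sum_{i=1}^k i|X_i|$. The chromatic sum $\Sigma(G)$ is the minimum of $\Sigma(X)$ over all valid colorings of $G$, and the chromatic strength $s(G)$ is the minimum number of colors used by a valid coloring $X$ with $\Sigma(X)=\Sigma(G)$. -}

module Defs where

open import Data.Nat using (ℕ; zero; suc; _+_; _*_; _∸_; _≤_; _<_; _⊓_; _/_; NonZero)
open import Data.Nat.Properties using (_≤?_)
open import Data.Bool using (Bool; true; false; T)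
open import Data.Fin using (Fin; toℕ; _≟_)
open import Data.Fin.Subset using (Subset; _∈_; ∣_∣)
open import Data.Nat.ListAction using (sum)
open import Data.List using (List; map; length; filter; allFin)
open import Data.Product using (Σ; ∃; _×_; _,_)
open import Relation.Nullary using (¬_; does; yes; no)
open import Relation.Binary.PropositionalEquality using (_≡_; _≢_)

record Graph (n : ℕ) : Set where
  field
    adj    : Fin n → Fin n → Bool
    sym    : ∀ u v → adj u v ≡ adj v u
    irrefl : ∀ v → adj v v ≡ false

open Graph public

Edge : ∀ {n} → Graph n → Fin n → Fin n → Set
Edge G u v = T (adj G u v)

Stable : ∀ {n} → Graph n → Subset n → Set
Stable G S = ∀ u v → u ∈ S → v ∈ S → ¬ Edge G u v

IsStabilityNumber : ∀ {n} → Graph n → ℕ → Set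
IsStabilityNumber {n} G a =
  (Σ (Subset n) λ S → Stable G S × ∣ S ∣ ≡ a) ×
  (∀ (S : Subset n) → Stable G S → ∣ S ∣ ≤ a)

-- A coloring with k colors is a map c : V → {1..k}; color (i : Fin k) stands
-- for the color toℕ i + 1, which is also its weight.
Valid : ∀ {n k} → Graph n → (Fin n → Fin k) → Set
Valid G c = ∀ u v → Edge G u v → c u ≢ c v

classSize : ∀ {n k} → (Fin n → Fin k) → Fin k → ℕ
classSize {n} c i = length (filter (λ v → c v ≟ i) (allFin n))

colSum : ∀ {n k} → (Fin n → Fin k) → ℕ
colSum {n} {k} c = sum (map (λ i → suc (toℕ i) * classSize c i) (allFin k))

IsChromaticSum : ∀ {n} → Graph n → ℕ → Set
IsChromaticSum {n} G σ =
  (Σ ℕ λ k → Σ (Fin n → Fin k) λ c → Valid G c × colSum c ≡ σ) ×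
  (∀ k (c : Fin n → Fin k) → Valid G c → σ ≤ colSum c)

IsChromaticStrength : ∀ {n} → Graph n → ℕ → Set
IsChromaticStrength {n} G s =
  Σ ℕ λ σ → IsChromaticSum G σ ×
    ((Σ (Fin n → Fin s) λ c → Valid G c × colSum c ≡ σ) ×
     (∀ k (c : Fin n → Fin k) → Valid G c → colSum c ≡ σ → s ≤ k))

lam : ℕ → ℕ → ℕ → ℕ
lam n a k = a ⊓ (n ∸ k + 1)

-- If λ_k ≥ 2 with β_k = ⌊(n-k)/(λ_k-1)⌋ (note λ_k - 1 = suc l below):
--   x ≤ β_k : λ_k ;  x = β_k+1 : n - β_k λ_k - (k - β_k - 1) ;  x > β_k+1 : 1.
-- If λ_k = 1 (or the degenerate λ_k = 0): 1.
Mk : ℕ → ℕ → ℕ → ℕ → ℕ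
Mk n a k x with lam n a k
... | zero = 1
... | suc zero = 1
... | suc (suc l) with (n ∸ k) / suc l
...   | β with x ≤? β
...     | yes _ = suc (suc l)
...     | no _ with x ≤? suc β
...       | yes _ = n ∸ β * suc (suc l) ∸ (k ∸ β ∸ 1)
...       | no _ = 1

sumM : ℕ → ℕ → ℕ → ℕ
sumM n a k = sum (map (λ (i : Fin k) → suc (toℕ i) * Mk n a k (suc (toℕ i))) (allFin k))

module Submission where

-- Let c' be a coloring attaining the chromatic sum Σ(G) with the fewest
-- colours, s = s(G) of them.  Two facts about c' drive the proof:
--   (a) no colour class of c' is empty: deleting an empty colour keeps the
--       coloring valid without raising its sum, against the minimality of s;
--   (b) every class of c' is a stable set, so it has at most α vertices.
-- For j < k, write tail_j(M_k) = M_k[j+1] + ⋯ + M_k[k].  By construction of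
-- M_k, tail_j(M_k) ≤ k − j or tail_j(M_k) ≤ n − jα.  By (a) and (b) the
-- classes of c' beyond colour j contain at least s − j and at least n − jα
-- vertices.  So if k ≤ s, every tail of M_k is dominated by the matching tail
-- of c', and Abel summation (Σ x·g_x = Σ_j tail_j g) yields Σ(M_k) ≤ Σ(c').
-- Were s ≥ k*, we would get Σ(G) = Σ(c') ≥ Σ(M_{k*}) > Σ(X) ≥ Σ(G).

open import Defs
open import Data.Nat using (ℕ; _<_; _≤_; _∸_)
open import Data.Fin using (Fin)

open import Data.Nat using (zero; suc; _+_; _*_; _/_; z≤n; s≤s)
open import Data.Nat.Properties
open import Data.Nat.DivMod using (m/n*n≤m)
open import Data.Nat.Tactic.RingSolver using (solve-∀)
open import Data.Nat.ListAction using (sum)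
open import Data.Fin using (toℕ; fromℕ<; punchOut)
import Data.Fin as Fin
import Data.Fin.Properties as Finₚ
open import Data.Fin.Subset using (Subset; _∈_; ∣_∣)
open import Data.Bool using (Bool; true; false; if_then_else_)
open import Data.List using (tabulate; filter; length; map; allFin)
open import Data.List.Properties using (map-tabulate)
import Data.Vec as Vec
import Data.Vec.Properties as Vecₚ
open import Data.Product using (Σ; _×_; _,_; proj₁; proj₂)
open import Data.Sum using (_⊎_; inj₁; inj₂)
open import Data.Empty using (⊥-elim)
open import Relation.Nullary using (¬_; Dec; does; yes; no; contradiction)
open import Relation.Unary using (Pred; Decidable)
open import Relation.Binary.PropositionalEquality hiding (sym)
import Relation.Binary.PropositionalEquality as ≡
open import Level using (0ℓ)

sumTo : ℕ → (ℕ → ℕ) → ℕ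
sumTo zero    f = 0
sumTo (suc k) f = f 0 + sumTo k (λ x → f (suc x))

sumTo-cong : ∀ k {f g : ℕ → ℕ} → (∀ x → x < k → f x ≡ g x) → sumTo k f ≡ sumTo k g
sumTo-cong zero    f≡g = refl
sumTo-cong (suc k) f≡g =
  cong₂ _+_ (f≡g 0 (s≤s z≤n)) (sumTo-cong k (λ x x<k → f≡g (suc x) (s≤s x<k)))

sumTo-mono : ∀ k {f g : ℕ → ℕ} → (∀ x → x < k → f x ≤ g x) → sumTo k f ≤ sumTo k g
sumTo-mono zero    f≤g = z≤n
sumTo-mono (suc k) f≤g =
  +-mono-≤ (f≤g 0 (s≤s z≤n)) (sumTo-mono k (λ x x<k → f≤g (suc x) (s≤s x<k)))

+-interchange : ∀ a b c d → (a + b) + (c + d) ≡ (a + c) + (b + d)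
+-interchange = solve-∀

sumTo-+ : ∀ k (f g : ℕ → ℕ) → sumTo k (λ x → f x + g x) ≡ sumTo k f + sumTo k g
sumTo-+ zero    f g = refl
sumTo-+ (suc k) f g =
  trans (cong (f 0 + g 0 +_) (sumTo-+ k (λ x → f (suc x)) (λ x → g (suc x))))
        (+-interchange (f 0) (g 0) _ _)

sumTo-split : ∀ p q f → sumTo (p + q) f ≡ sumTo p f + sumTo q (λ x → f (p + x))
sumTo-split zero    q f = refl
sumTo-split (suc p) q f =
  trans (cong (f 0 +_) (sumTo-split p q (λ x → f (suc x)))) (≡.sym (+-assoc (f 0) _ _))

sumTo-const : ∀ k c → sumTo k (λ _ → c) ≡ k * c
sumTo-const zero    c = refl
sumTo-const (suc k) c = cong (c +_) (sumTo-const k c)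

sumTo-zeros : ∀ k {f : ℕ → ℕ} → (∀ x → x < k → f x ≡ 0) → sumTo k f ≡ 0
sumTo-zeros k f≡0 = trans (sumTo-cong k f≡0) (trans (sumTo-const k 0) (*-zeroʳ k))

sumTo-ones : ∀ k {f : ℕ → ℕ} → (∀ x → x < k → f x ≡ 1) → sumTo k f ≡ k
sumTo-ones k f≡1 = trans (sumTo-cong k f≡1) (trans (sumTo-const k 1) (*-identityʳ k))

sumFin : ∀ n → (Fin n → ℕ) → ℕ
sumFin zero    h = 0
sumFin (suc n) h = h Fin.zero + sumFin n (λ v → h (Fin.suc v))

sumFin-cong : ∀ n {h h′ : Fin n → ℕ} → (∀ v → h v ≡ h′ v) → sumFin n h ≡ sumFin n h′
sumFin-cong zero    h≡h′ = refl
sumFin-cong (suc n) h≡h′ = cong₂ _+_ (h≡h′ Fin.zero) (sumFin-cong n (λ v → h≡h′ (Fin.suc v)))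

sumFin-mono : ∀ n {h h′ : Fin n → ℕ} → (∀ v → h v ≤ h′ v) → sumFin n h ≤ sumFin n h′
sumFin-mono zero    h≤h′ = z≤n
sumFin-mono (suc n) h≤h′ = +-mono-≤ (h≤h′ Fin.zero) (sumFin-mono n (λ v → h≤h′ (Fin.suc v)))

sumFin-const : ∀ n c → sumFin n (λ _ → c) ≡ n * c
sumFin-const zero    c = refl
sumFin-const (suc n) c = cong (c +_) (sumFin-const n c)

*-distribˡ-sumFin : ∀ n c (h : Fin n → ℕ) → c * sumFin n h ≡ sumFin n (λ v → c * h v)
*-distribˡ-sumFin zero    c h = *-zeroʳ c
*-distribˡ-sumFin (suc n) c h =
  trans (*-distribˡ-+ c (h Fin.zero) _) (cong (c * h Fin.zero +_) (*-distribˡ-sumFin n c _))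

sumFin-sumTo-swap : ∀ n k (g : Fin n → ℕ → ℕ) →
  sumFin n (λ v → sumTo k (g v)) ≡ sumTo k (λ x → sumFin n (λ v → g v x))
sumFin-sumTo-swap zero    k g = ≡.sym (sumTo-zeros k (λ _ _ → refl))
sumFin-sumTo-swap (suc n) k g =
  trans (cong (sumTo k (g Fin.zero) +_) (sumFin-sumTo-swap n k (λ v → g (Fin.suc v))))
        (≡.sym (sumTo-+ k (g Fin.zero) _))

sumFin≡0⇒≡0 : ∀ n (h : Fin n → ℕ) → sumFin n h ≡ 0 → ∀ v → h v ≡ 0
sumFin≡0⇒≡0 (suc n) h sum≡0 Fin.zero    = m+n≡0⇒m≡0 (h Fin.zero) sum≡0
sumFin≡0⇒≡0 (suc n) h sum≡0 (Fin.suc v) = sumFin≡0⇒≡0 n _ (m+n≡0⇒n≡0 (h Fin.zero) sum≡0) v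

sum-tabulate : ∀ n (h : Fin n → ℕ) → sum (tabulate h) ≡ sumFin n h
sum-tabulate zero    h = refl
sum-tabulate (suc n) h = cong (h Fin.zero +_) (sum-tabulate n (λ v → h (Fin.suc v)))

sum-map-allFin : ∀ n (h : Fin n → ℕ) → sum (map h (allFin n)) ≡ sumFin n h
sum-map-allFin n h = trans (cong sum (map-tabulate (λ v → v) h)) (sum-tabulate n h)

sumFin-toℕ : ∀ k (f : ℕ → ℕ) → sumFin k (λ i → f (toℕ i)) ≡ sumTo k f
sumFin-toℕ zero    f = refl
sumFin-toℕ (suc k) f = cong (f 0 +_) (sumFin-toℕ k (λ x → f (suc x)))

tailSum : ℕ → (ℕ → ℕ) → ℕ → ℕ
tailSum k f j = sumTo (k ∸ j) (λ x → f (j + x))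

prefix+tail : ∀ k f j → j ≤ k → sumTo j f + tailSum k f j ≡ sumTo k f
prefix+tail k f j j≤k =
  trans (≡.sym (sumTo-split j (k ∸ j) f)) (cong (λ m → sumTo m f) (m+[n∸m]≡n j≤k))

weightedSum-step : ∀ k (g : ℕ → ℕ) →
  sumTo (suc k) (λ x → suc x * g x) ≡ sumTo (suc k) g + sumTo k (λ x → suc x * g (suc x))
weightedSum-step k g = begin
    1 * g 0 + sumTo k (λ x → g (suc x) + suc x * g (suc x))
  ≡⟨ cong₂ _+_ (*-identityˡ (g 0)) (sumTo-+ k (λ x → g (suc x)) (λ x → suc x * g (suc x))) ⟩
    g 0 + (sumTo k (λ x → g (suc x)) + sumTo k (λ x → suc x * g (suc x)))
  ≡⟨ ≡.sym (+-assoc (g 0) _ _) ⟩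
    g 0 + sumTo k (λ x → g (suc x)) + sumTo k (λ x → suc x * g (suc x))
  ∎
  where open ≡-Reasoning

weightedSum-mono : ∀ k s (g f : ℕ → ℕ) → k ≤ s →
  (∀ j → j < k → tailSum k g j ≤ tailSum s f j) →
  sumTo k (λ x → suc x * g x) ≤ sumTo s (λ x → suc x * f x)
weightedSum-mono zero    s       g f _         tails = z≤n
weightedSum-mono (suc k) (suc s) g f (s≤s k≤s) tails =
  subst₂ _≤_ (≡.sym (weightedSum-step k g)) (≡.sym (weightedSum-step s f))
    (+-mono-≤ (tails 0 (s≤s z≤n))
      (weightedSum-mono k s (λ x → g (suc x)) (λ x → f (suc x)) k≤s
        (λ j j<k → tails (suc j) (s≤s j<k))))

δ : ℕ → ℕ → ℕ
δ zero    zero    = 1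
δ zero    (suc x) = 0
δ (suc y) zero    = 0
δ (suc y) (suc x) = δ y x

δ-refl : ∀ y → δ y y ≡ 1
δ-refl zero    = refl
δ-refl (suc y) = δ-refl y

δ-≢ : ∀ {y x} → y ≢ x → δ y x ≡ 0
δ-≢ {zero}  {zero}  y≢x = ⊥-elim (y≢x refl)
δ-≢ {zero}  {suc x} y≢x = refl
δ-≢ {suc y} {zero}  y≢x = refl
δ-≢ {suc y} {suc x} y≢x = δ-≢ (λ y≡x → y≢x (cong suc y≡x))

sumTo-δ : ∀ s y (g : ℕ → ℕ) → y < s → sumTo s (λ x → g x * δ y x) ≡ g y
sumTo-δ (suc s) zero    g _ =
  trans (cong₂ _+_ (*-identityʳ (g 0)) (sumTo-zeros s (λ x _ → *-zeroʳ (g (suc x)))))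
        (+-identityʳ (g 0))
sumTo-δ (suc s) (suc y) g (s≤s y<s) =
  trans (cong (_+ sumTo s (λ x → g (suc x) * δ y x)) (*-zeroʳ (g 0))) (sumTo-δ s y (λ x → g (suc x)) y<s)

indicator≡δ : ∀ {A : Set} (num : A → ℕ) → (∀ {u i} → num u ≡ num i → u ≡ i) →
  ∀ {u i} (u≟i : Dec (u ≡ i)) → (if does u≟i then 1 else 0) ≡ δ (num u) (num i)
indicator≡δ num injective (yes refl) = ≡.sym (δ-refl (num _))
indicator≡δ num injective (no u≢i)   = ≡.sym (δ-≢ (λ e → u≢i (injective e)))

classCount : ∀ {n k} → (Fin n → Fin k) → ℕ → ℕ
classCount {n} c x = sumFin n (λ v → δ (toℕ (c v)) x)

length-filter : ∀ {m} {P : Pred (Fin m) 0ℓ} (P? : Decidable P) n (g : Fin n → Fin m) →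
  length (filter P? (tabulate g)) ≡ sumFin n (λ v → if does (P? (g v)) then 1 else 0)
length-filter P? zero    g = refl
length-filter P? (suc n) g with does (P? (g Fin.zero))
... | true  = cong suc (length-filter P? n (λ v → g (Fin.suc v)))
... | false = length-filter P? n (λ v → g (Fin.suc v))

classSize≡classCount : ∀ {n k} (c : Fin n → Fin k) i → classSize c i ≡ classCount c (toℕ i)
classSize≡classCount {n} c i =
  trans (length-filter (λ v → c v Fin.≟ i) n (λ v → v))
        (sumFin-cong n (λ v → indicator≡δ toℕ Finₚ.toℕ-injective (c v Fin.≟ i)))

colSum≡weightedSum : ∀ {n k} (c : Fin n → Fin k) →
  colSum c ≡ sumTo k (λ x → suc x * classCount c x)
colSum≡weightedSum {n} {k} c =
  trans (sum-map-allFin k (λ i → suc (toℕ i) * classSize c i))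
  (trans (sumFin-cong k (λ i → cong (suc (toℕ i) *_) (classSize≡classCount c i)))
         (sumFin-toℕ k (λ x → suc x * classCount c x)))

double-counting : ∀ {n k} (c : Fin n → Fin k) (g : ℕ → ℕ) →
  sumTo k (λ x → g x * classCount c x) ≡ sumFin n (λ v → g (toℕ (c v)))
double-counting {n} {k} c g =
  trans (sumTo-cong k (λ x _ → *-distribˡ-sumFin n (g x) _))
  (trans (≡.sym (sumFin-sumTo-swap n k (λ v x → g x * δ (toℕ (c v)) x)))
         (sumFin-cong n (λ v → sumTo-δ k (toℕ (c v)) g (Finₚ.toℕ<n (c v)))))

classCount-total : ∀ {n k} (c : Fin n → Fin k) → sumTo k (classCount c) ≡ n
classCount-total {n} {k} c =
  trans (sumTo-cong k (λ x _ → ≡.sym (*-identityˡ (classCount c x))))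
  (trans (double-counting c (λ _ → 1)) (trans (sumFin-const n 1) (*-identityʳ n)))

colSum≡vertexSum : ∀ {n k} (c : Fin n → Fin k) → colSum c ≡ sumFin n (λ v → suc (toℕ (c v)))
colSum≡vertexSum c = trans (colSum≡weightedSum c) (double-counting c suc)

∣tabulate∣ : ∀ n (b : Fin n → Bool) → ∣ Vec.tabulate b ∣ ≡ sumFin n (λ v → if b v then 1 else 0)
∣tabulate∣ zero    b = refl
∣tabulate∣ (suc n) b with b Fin.zero
... | true  = cong suc (∣tabulate∣ n (λ v → b (Fin.suc v)))
... | false = ∣tabulate∣ n (λ v → b (Fin.suc v))

does-true : ∀ {A : Set} (a? : Dec A) → does a? ≡ true → A
does-true (yes a) _  = a
does-true (no _)  ()

-- A colour class of a valid coloring is a stable set, so it has at most α vertices.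
classCount≤α : ∀ {n k} (G : Graph n) (a : ℕ) → (∀ (S : Subset n) → Stable G S → ∣ S ∣ ≤ a) →
  (c : Fin n → Fin k) → Valid G c → ∀ x → classCount c x ≤ a
classCount≤α {n} G a maxStable c valid x = subst (_≤ a) ∣class∣ (maxStable class stable)
  where
  inClass : Fin n → Bool
  inClass v = does (toℕ (c v) ≟ x)
  class : Subset n
  class = Vec.tabulate inClass
  ∣class∣ : ∣ class ∣ ≡ classCount c x
  ∣class∣ = trans (∣tabulate∣ n inClass)
                  (sumFin-cong n (λ v → indicator≡δ (λ y → y) (λ e → e) (toℕ (c v) ≟ x)))
  colour : ∀ u → u ∈ class → toℕ (c u) ≡ x
  colour u u∈ = does-true (toℕ (c u) ≟ x) (trans (≡.sym (Vecₚ.lookup∘tabulate inClass u)) (Vecₚ.[]=⇒lookup u∈))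
  stable : Stable G class
  stable u v u∈ v∈ edge =
    valid u v edge (Finₚ.toℕ-injective (trans (colour u u∈) (≡.sym (colour v v∈))))

toℕ-punchOut-≤ : ∀ {m} {i j : Fin (suc m)} (i≢j : i ≢ j) → toℕ (punchOut i≢j) ≤ toℕ j
toℕ-punchOut-≤ {_}     {Fin.zero}  {Fin.zero}  i≢j = ⊥-elim (i≢j refl)
toℕ-punchOut-≤ {_}     {Fin.zero}  {Fin.suc j} i≢j = n≤1+n (toℕ j)
toℕ-punchOut-≤ {suc _} {Fin.suc i} {Fin.zero}  i≢j = z≤n
toℕ-punchOut-≤ {suc _} {Fin.suc i} {Fin.suc j} i≢j =
  s≤s (toℕ-punchOut-≤ (λ e → i≢j (cong Fin.suc e)))

dropColour : ∀ {n s} (G : Graph n) (c : Fin n → Fin (suc s)) (i : Fin (suc s)) →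
  (∀ v → i ≢ c v) → Valid G c →
  Σ (Fin n → Fin s) λ c′ → Valid G c′ × colSum c′ ≤ colSum c
dropColour {n} G c i unused valid = c′ , valid′ , sum≤
  where
  c′ : Fin n → Fin _
  c′ v = punchOut (unused v)
  valid′ : Valid G c′
  valid′ u v edge same = valid u v edge (Finₚ.punchOut-injective (unused u) (unused v) same)
  sum≤ : colSum c′ ≤ colSum c
  sum≤ = subst₂ _≤_ (≡.sym (colSum≡vertexSum c′)) (≡.sym (colSum≡vertexSum c))
           (sumFin-mono n (λ v → s≤s (toℕ-punchOut-≤ (unused v))))

classCount≡0⇒unused : ∀ {n k} (c : Fin n → Fin k) x → classCount c x ≡ 0 → ∀ v → toℕ (c v) ≢ x
classCount≡0⇒unused {n} c x empty v refl =
  0≢1+n (trans (≡.sym (sumFin≡0⇒≡0 n _ empty v)) (δ-refl (toℕ (c v))))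

fewestColours⇒nonempty : ∀ {n} (G : Graph n) σ s (c : Fin n → Fin s) →
  Valid G c → colSum c ≡ σ →
  (∀ k (c : Fin n → Fin k) → Valid G c → σ ≤ colSum c) →
  (∀ k (c : Fin n → Fin k) → Valid G c → colSum c ≡ σ → s ≤ k) →
  ∀ x → x < s → 1 ≤ classCount c x
fewestColours⇒nonempty G σ (suc s) c valid c≡σ optimal fewest x x<s with classCount c x in count
... | suc _ = s≤s z≤n
... | zero  = contradiction (fewest s c′ valid′ c′≡σ) 1+n≰n
  where
  unused : ∀ v → fromℕ< x<s ≢ c v
  unused v e = classCount≡0⇒unused c x count v
                 (trans (cong toℕ (≡.sym e)) (Finₚ.toℕ-fromℕ< x<s))
  dropped : Σ (Fin _ → Fin s) λ c′ → Valid G c′ × colSum c′ ≤ colSum c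
  dropped = dropColour G c (fromℕ< x<s) unused valid
  c′ : Fin _ → Fin s
  c′ = proj₁ dropped
  valid′ : Valid G c′
  valid′ = proj₁ (proj₂ dropped)
  c′≡σ : colSum c′ ≡ σ
  c′≡σ = ≤-antisym (subst (colSum c′ ≤_) c≡σ (proj₂ (proj₂ dropped))) (optimal s c′ valid′)

Mseq : ℕ → ℕ → ℕ → ℕ → ℕ
Mseq n a k x = Mk n a k (suc x)

sumM≡weightedSum : ∀ n a k → sumM n a k ≡ sumTo k (λ x → suc x * Mseq n a k x)
sumM≡weightedSum n a k =
  trans (sum-map-allFin k _) (sumFin-toℕ k (λ x → suc x * Mseq n a k x))

-- The entries of M_k read off its definition.  When λ_k ≥ 2 we write
-- λ_k = l + 2, so that β_k = ⌊(n − k)/(l + 1)⌋.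

Mk-λ≤1 : ∀ n a k x → lam n a k ≤ 1 → Mk n a k x ≡ 1
Mk-λ≤1 n a k x λ≤1 with lam n a k
... | zero        = refl
... | suc zero    = refl
Mk-λ≤1 n a k x (s≤s ()) | suc (suc l)

Mk-≤β : ∀ n a k x l → lam n a k ≡ suc (suc l) → x ≤ (n ∸ k) / suc l →
  Mk n a k x ≡ suc (suc l)
Mk-≤β n a k x l λ≡ x≤β with lam n a k | λ≡
... | .(suc (suc l)) | refl with x ≤? (n ∸ k) / suc l
...   | yes _   = refl
...   | no  x≰β = contradiction x≤β x≰β

Mk-β+1 : ∀ n a k x l → lam n a k ≡ suc (suc l) → x ≡ suc ((n ∸ k) / suc l) →
  Mk n a k x ≡ n ∸ ((n ∸ k) / suc l) * suc (suc l) ∸ (k ∸ (n ∸ k) / suc l ∸ 1)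
Mk-β+1 n a k x l λ≡ x≡β+1 with lam n a k | λ≡
... | .(suc (suc l)) | refl with x ≤? (n ∸ k) / suc l
...   | yes x≤β = contradiction (subst (_≤ (n ∸ k) / suc l) x≡β+1 x≤β) 1+n≰n
...   | no  _   with x ≤? suc ((n ∸ k) / suc l)
...     | yes _     = refl
...     | no  x≰β+1 = contradiction (≤-reflexive x≡β+1) x≰β+1

Mk->β+1 : ∀ n a k x l → lam n a k ≡ suc (suc l) → suc ((n ∸ k) / suc l) < x →
  Mk n a k x ≡ 1
Mk->β+1 n a k x l λ≡ β+1<x with lam n a k | λ≡
... | .(suc (suc l)) | refl with x ≤? (n ∸ k) / suc l
...   | yes x≤β = contradiction (≤-trans x≤β (n≤1+n _)) (<⇒≱ β+1<x)
...   | no  _   with x ≤? suc ((n ∸ k) / suc l)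
...     | yes x≤β+1 = contradiction x≤β+1 (<⇒≱ β+1<x)
...     | no  _     = refl

module Staircase (n k β l : ℕ) (M : ℕ → ℕ)
  (β-bound : β * suc l ≤ n ∸ k) (k≤n : k ≤ n)
  (M-low  : ∀ x → x < β → M x ≡ suc (suc l))
  (M-mid  : M β ≡ n ∸ β * suc (suc l) ∸ (k ∸ β ∸ 1))
  (M-high : ∀ x → β < x → M x ≡ 1) where

  L : ℕ
  L = suc (suc l)

  prefix : ∀ j → j ≤ β → sumTo j M ≡ j * L
  prefix j j≤β = trans (sumTo-cong j (λ x x<j → M-low x (<-≤-trans x<j j≤β))) (sumTo-const j L)

  module _ (e : ℕ) (β+1+e≡k : suc β + e ≡ k) where

    βL+e≤n : β * L + e ≤ n
    βL+e≤n = begin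
      β * L + e            ≡⟨ cong (_+ e) (*-suc β (suc l)) ⟩
      β + β * suc l + e    ≡⟨ regroup β (β * suc l) e ⟩
      β * suc l + (β + e)  ≤⟨ +-mono-≤ β-bound (subst (β + e ≤_) β+1+e≡k (n≤1+n (β + e))) ⟩
      n ∸ k + k            ≡⟨ m∸n+n≡m k≤n ⟩
      n                    ∎
      where
      open ≤-Reasoning
      regroup : ∀ b c e → b + c + e ≡ c + (b + e)
      regroup = solve-∀

    total-long : sumTo k M ≡ n
    total-long = begin
      sumTo k M
        ≡⟨ cong (λ m → sumTo m M) (trans (≡.sym β+1+e≡k) (≡.sym (+-suc β e))) ⟩
      sumTo (β + suc e) M
        ≡⟨ sumTo-split β (suc e) M ⟩
      sumTo β M + (M (β + 0) + sumTo e (λ x → M (β + suc x)))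
        ≡⟨ cong₂ _+_ (prefix β ≤-refl) (cong₂ _+_ (trans (cong M (+-identityʳ β)) M-mid) ones) ⟩
      β * L + (n ∸ β * L ∸ (k ∸ β ∸ 1) + e)
        ≡⟨ cong (λ z → β * L + (n ∸ β * L ∸ z + e)) k∸β∸1≡e ⟩
      β * L + (n ∸ β * L ∸ e + e)
        ≡⟨ cong (β * L +_) (m∸n+n≡m (m+n≤o⇒m≤o∸n e (subst (_≤ n) (+-comm (β * L) e) βL+e≤n))) ⟩
      β * L + (n ∸ β * L)
        ≡⟨ m+[n∸m]≡n (m+n≤o⇒m≤o (β * L) βL+e≤n) ⟩
      n ∎
      where
      open ≡-Reasoning
      ones : sumTo e (λ x → M (β + suc x)) ≡ e
      ones = sumTo-ones e (λ x _ → M-high (β + suc x) (m<m+n β (s≤s z≤n)))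
      k∸β∸1≡e : k ∸ β ∸ 1 ≡ e
      k∸β∸1≡e = trans (∸-+-assoc k β 1)
                  (trans (cong (k ∸_) (+-comm β 1))
                         (trans (cong (_∸ suc β) (≡.sym β+1+e≡k)) (m+n∸m≡n (suc β) e)))

  total≤n : sumTo k M ≤ n
  total≤n with suc β ≤? k
  ... | yes β<k = ≤-reflexive (total-long (k ∸ suc β) (m+[n∸m]≡n β<k))
  ... | no  β≮k = begin
      sumTo k M           ≡⟨ prefix k k≤β ⟩
      k * L               ≡⟨ *-suc k (suc l) ⟩
      k + k * suc l       ≤⟨ +-monoʳ-≤ k (≤-trans (*-monoˡ-≤ (suc l) k≤β) β-bound) ⟩
      k + (n ∸ k)         ≡⟨ m+[n∸m]≡n k≤n ⟩
      n                   ∎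
    where
    open ≤-Reasoning
    k≤β : k ≤ β
    k≤β = ≤-pred (≰⇒> β≮k)

  tail-low : ∀ j → j ≤ β → j ≤ k → tailSum k M j + j * L ≤ n
  tail-low j j≤β j≤k = begin
    tailSum k M j + j * L      ≡⟨ +-comm (tailSum k M j) (j * L) ⟩
    j * L + tailSum k M j      ≡⟨ cong (_+ tailSum k M j) (≡.sym (prefix j j≤β)) ⟩
    sumTo j M + tailSum k M j  ≡⟨ prefix+tail k M j j≤k ⟩
    sumTo k M                  ≤⟨ total≤n ⟩
    n                          ∎
    where open ≤-Reasoning

  tail-high : ∀ j → β < j → tailSum k M j ≡ k ∸ j
  tail-high j β<j = sumTo-ones (k ∸ j) (λ x _ → M-high (j + x) (<-≤-trans β<j (m≤m+n j x)))

leftover-bound : ∀ n k j t → k ≤ n → suc j ≤ k →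
  t + suc j * suc (n ∸ k) ≤ n → t ≤ k ∸ suc j
leftover-bound n k j t k≤n j<k fits =
  +-cancelˡ-≤ (suc j * d′) t e (≤-trans (≤-reflexive (+-comm (suc j * d′) t)) (≤-trans fits n≤))
  where
  open ≤-Reasoning
  d′ : ℕ
  d′ = suc (n ∸ k)
  e : ℕ
  e = k ∸ suc j
  regroup : ∀ d j e → d + (suc j + e) ≡ suc d + j + e
  regroup = solve-∀
  n≤ : n ≤ suc j * d′ + e
  n≤ = begin
    n                         ≡⟨ ≡.sym (m∸n+n≡m k≤n) ⟩
    n ∸ k + k                 ≡⟨ cong (n ∸ k +_) (≡.sym (m+[n∸m]≡n j<k)) ⟩
    n ∸ k + (suc j + e)       ≡⟨ regroup (n ∸ k) j e ⟩
    d′ + j + e                ≤⟨ +-monoˡ-≤ e (+-monoʳ-≤ d′ (m≤m*n j d′)) ⟩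
    d′ + j * d′ + e           ∎

-- If j entries λ_k = min(α, n − k + 1) fit in front of a tail t, then
-- t ≤ k − j or t ≤ n − jα: when λ_k = α this is immediate, and when
-- λ_k = n − k + 1 (with j ≥ 1) it is the leftover bound.
tail-from-λ : ∀ n a k j t L → lam n a k ≡ L → k ≤ n → j < k →
  t + j * L ≤ n → t ≤ k ∸ j ⊎ t + j * a ≤ n
tail-from-λ n a k zero    t L _   _   _   fits = inj₂ fits
tail-from-λ n a k (suc j) t L λ≡L k≤n j<k fits with ⊓-sel a (n ∸ k + 1)
... | inj₁ λ≡α     = inj₂ (subst (λ z → t + suc j * z ≤ n) (trans (≡.sym λ≡L) λ≡α) fits)
... | inj₂ λ≡n-k+1 = inj₁ (leftover-bound n k j t k≤n (<⇒≤ j<k)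
                       (subst (λ z → t + suc j * z ≤ n)
                              (trans (≡.sym λ≡L) (trans λ≡n-k+1 (+-comm (n ∸ k) 1))) fits))

module StaircaseM (n a k l : ℕ) (λ≡ : lam n a k ≡ suc (suc l)) (k≤n : k ≤ n) where

  β : ℕ
  β = (n ∸ k) / suc l

  open Staircase n k β l (Mseq n a k) (m/n*n≤m (n ∸ k) (suc l)) k≤n
         (λ x x<β → Mk-≤β n a k (suc x) l λ≡ x<β)
         (Mk-β+1 n a k (suc β) l λ≡ refl)
         (λ x β<x → Mk->β+1 n a k (suc x) l λ≡ (s≤s β<x))

  tail-bound : ∀ j → j < k →
    tailSum k (Mseq n a k) j ≤ k ∸ j ⊎ tailSum k (Mseq n a k) j + j * a ≤ n
  tail-bound j j<k with j ≤? β
  ... | yes j≤β = tail-from-λ n a k j _ _ λ≡ k≤n j<k (tail-low j j≤β (<⇒≤ j<k))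
  ... | no  j≰β = inj₁ (≤-reflexive (tail-high j (≰⇒> j≰β)))

Mseq-tail : ∀ n a k j → k ≤ n → j < k →
  tailSum k (Mseq n a k) j ≤ k ∸ j ⊎ tailSum k (Mseq n a k) j + j * a ≤ n
Mseq-tail n a k j k≤n j<k = by-λ (lam n a k) refl
  where
  all-ones : lam n a k ≤ 1 → tailSum k (Mseq n a k) j ≤ k ∸ j
  all-ones λ≤1 = ≤-reflexive (sumTo-ones (k ∸ j) (λ x _ → Mk-λ≤1 n a k _ λ≤1))
  by-λ : ∀ v → lam n a k ≡ v →
    tailSum k (Mseq n a k) j ≤ k ∸ j ⊎ tailSum k (Mseq n a k) j + j * a ≤ n
  by-λ zero          λ≡ = inj₁ (all-ones (subst (_≤ 1) (≡.sym λ≡) z≤n))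
  by-λ (suc zero)    λ≡ = inj₁ (all-ones (subst (_≤ 1) (≡.sym λ≡) ≤-refl))
  by-λ (suc (suc l)) λ≡ = StaircaseM.tail-bound n a k l λ≡ k≤n j j<k

module ColouringTails {n s : ℕ} (a : ℕ) (c : Fin n → Fin s)
  (nonempty : ∀ x → x < s → 1 ≤ classCount c x)
  (small    : ∀ x → classCount c x ≤ a) where

  many : ∀ j → j ≤ s → s ∸ j ≤ tailSum s (classCount c) j
  many j j≤s = begin
    s ∸ j                            ≡⟨ ≡.sym (sumTo-ones (s ∸ j) (λ _ _ → refl)) ⟩
    sumTo (s ∸ j) (λ _ → 1)          ≤⟨ sumTo-mono (s ∸ j) (λ x x<s∸j → nonempty (j + x) (j+x<s x<s∸j)) ⟩
    tailSum s (classCount c) j       ∎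
    where
    open ≤-Reasoning
    j+x<s : ∀ {x} → x < s ∸ j → j + x < s
    j+x<s x<s∸j = subst (_ <_) (m+[n∸m]≡n j≤s) (+-monoʳ-< j x<s∸j)

  -- The first j classes hold at most jα vertices, the rest hold the others.
  large : ∀ j → j ≤ s → n ≤ j * a + tailSum s (classCount c) j
  large j j≤s = begin
    n                                           ≡⟨ ≡.sym (classCount-total c) ⟩
    sumTo s (classCount c)                      ≡⟨ ≡.sym (prefix+tail s (classCount c) j j≤s) ⟩
    sumTo j (classCount c) + tailSum s (classCount c) j
      ≤⟨ +-monoˡ-≤ _ (subst (sumTo j (classCount c) ≤_) (sumTo-const j a)
                          (sumTo-mono j (λ x _ → small x))) ⟩
    j * a + tailSum s (classCount c) j          ∎
    where open ≤-Reasoning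

  sumM≤colSum : ∀ k → k ≤ n → k ≤ s → sumM n a k ≤ colSum c
  sumM≤colSum k k≤n k≤s = begin
    sumM n a k                               ≡⟨ sumM≡weightedSum n a k ⟩
    sumTo k (λ x → suc x * Mseq n a k x)     ≤⟨ weightedSum-mono k s _ _ k≤s dominated ⟩
    sumTo s (λ x → suc x * classCount c x)   ≡⟨ ≡.sym (colSum≡weightedSum c) ⟩
    colSum c                                 ∎
    where
    open ≤-Reasoning
    dominated : ∀ j → j < k → tailSum k (Mseq n a k) j ≤ tailSum s (classCount c) j
    dominated j j<k = combine (Mseq-tail n a k j k≤n j<k)
      where
      j≤s : j ≤ s
      j≤s = ≤-trans (<⇒≤ j<k) k≤s
      combine : tailSum k (Mseq n a k) j ≤ k ∸ j ⊎ tailSum k (Mseq n a k) j + j * a ≤ n →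
        tailSum k (Mseq n a k) j ≤ tailSum s (classCount c) j
      combine (inj₁ few)    = ≤-trans few (≤-trans (∸-monoˡ-≤ j k≤s) (many j j≤s))
      combine (inj₂ little) = +-cancelˡ-≤ (j * a) _ _
        (≤-trans (≤-reflexive (+-comm (j * a) _)) (≤-trans little (large j j≤s)))

-- The theorem.  If s(G) ≥ k*, an optimal coloring c′ with s(G) colours has
-- nonempty classes of size ≤ α, so Σ(G) = Σ(c′) ≥ Σ(M_{k*}) > Σ(X) ≥ Σ(G).
mainTheorem2 : ∀ {n} (G : Graph n) (a : ℕ) → IsStabilityNumber G a →
    (m : ℕ) (c : Fin n → Fin m) → Valid G c →
    (kstar : ℕ) → m < kstar → kstar ≤ n → colSum c < sumM n a kstar →
    (∀ k → m < k → k < kstar → sumM n a k ≤ colSum c) →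
    (s : ℕ) → IsChromaticStrength G s → s ≤ kstar ∸ 1
mainTheorem2 {n} G a (_ , maxStable) m c valid kstar m<k* k*≤n Σc<ΣM _ s
  (σ , (_ , optimal) , (c′ , valid′ , c′≡σ) , fewest) =
  ≤-pred (subst (s <_) (≡.sym (m+[n∸m]≡n 1≤k*)) (≰⇒> k*≰s))
  where
  open ColouringTails a c′
         (fewestColours⇒nonempty G σ s c′ valid′ c′≡σ optimal fewest)
         (classCount≤α G a maxStable c′ valid′)
  1≤k* : 1 ≤ kstar
  1≤k* = ≤-trans (s≤s z≤n) m<k*
  k*≰s : ¬ (kstar ≤ s)
  k*≰s k*≤s = <⇒≱ Σc<ΣM (begin
    sumM n a kstar   ≤⟨ sumM≤colSum kstar k*≤n k*≤s ⟩
    colSum c′        ≡⟨ c′≡σ ⟩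
    σ                ≤⟨ optimal m c valid ⟩
    colSum c         ∎)
    where open ≤-Reasoning
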